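{- There is an absolute constant $c_0>0$ such that the following holds. For positive integers $n,t$ with $n^2\le t<n^{2.81}$, call $X\in\mathbb{F}_2^{t\times n^2}$ bad if there exist an integer $r$ with $n^2\le r<t$ and a factorization $X=X_1X_2$ with $X_1\in\mathbb{F}_2^{t\times r}$, $X_2\in\mathbb{F}_2^{r\times n^2}$ and $\frac{T(X_1)}{t-r}<c_0\frac{n^2}{\log n}$. Then, for all sufficiently large $n$ (and all such $t$), most matrices $X\in\mathbb{F}_2^{t\times n^2}$ are not bad; that is, the minimum of $\frac{T(X_1)}{t-r}$ over all such $r$ and factorizations is $\Omega(n^2/\log n)$ for most $X$.
   Context: For a matrix $X\in\mathbb{F}_2^{a\times b}$, $T(X)$ denotes the minimum number of arithmetic operations of a linear algorithm (linear circuit over $\mathbb{F}_2$) computing $v\mapsto Xv$. "Most" means that the fraction of bad matrices among all $2^{tn^2}$ matrices tends to $0$ as $n\to\infty$. -}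

module Defs where

open import Data.Nat using (ℕ; zero; suc; _+_; _*_; _∸_; _^_; _≤_; _<_)
open import Data.Nat.Logarithm using (⌊log₂_⌋)
open import Data.Bool using (Bool; true; false; _xor_; _∧_)
open import Data.Fin using (Fin; zero; suc; _≟_)
open import Data.Sum using (_⊎_; inj₁; inj₂)
open import Data.Product using (Σ; _×_; _,_)
open import Data.Maybe using (Maybe; just; nothing)
open import Relation.Nullary.Decidable using (⌊_⌋)
open import Relation.Binary.PropositionalEquality using (_≡_)

-- Matrices over F₂ (Bool with xor as +, ∧ as ·), a rows and b columns.
Mat : ℕ → ℕ → Set
Mat a b = Fin a → Fin b → Bool

xorSum : ∀ {m} → (Fin m → Bool) → Bool
xorSum {zero}  f = false
xorSum {suc m} f = f zero xor xorSum (λ k → f (suc k))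

_⊗_ : ∀ {a r b} → Mat a r → Mat r b → Mat a b
(A ⊗ B) i j = xorSum (λ k → A i k ∧ B k j)

-- Linear forms on F₂^b, given by their coefficient vectors.
Form : ℕ → Set
Form b = Fin b → Bool

unitForm : ∀ {b} → Fin b → Form b
unitForm k x = ⌊ k ≟ x ⌋

-- Nodes of a linear circuit with b inputs and s addition gates:
-- an input variable, or a gate (gate zero = the most recently added one).
Node : ℕ → ℕ → Set
Node b s = Fin b ⊎ Fin s

-- A linear straight-line program over F₂: a sequence of s gates, each gate
-- computing the sum of two previously computed nodes (one F₂-operation each).
data Gates (b : ℕ) : ℕ → Set where
  []  : Gates b zero
  _▷_ : ∀ {s} → Gates b s → Node b s × Node b s → Gates b (suc s)

eval : ∀ {b s} → Gates b s → Node b s → Form b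
eval g (inj₁ k) = unitForm k
eval [] (inj₂ ())
eval (g ▷ (u , v)) (inj₂ zero) x = eval g u x xor eval g v x
eval (g ▷ _) (inj₂ (suc j)) = eval g (inj₂ j)

outForm : ∀ {b s} → Gates b s → Maybe (Node b s) → Form b
outForm g (just u) = eval g u
outForm g nothing  = λ _ → false

HasCircuit : ∀ {a b} → Mat a b → ℕ → Set
HasCircuit {a} {b} X s =
  Σ (Gates b s) λ g → Σ (Fin a → Maybe (Node b s)) λ out →
    ∀ i j → outForm g (out i) j ≡ X i j

-- T(X) < B  ⇔  some linear circuit for X uses s operations with s < B.
-- Bad X (for c₀ = p / q, log replaced by ⌊log₂ n⌋):
-- ∃ r, n² ≤ r < t, X = X₁X₂, and T(X₁)·⌊log₂ n⌋ < c₀ (t − r) n².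
Bad : (p q n t : ℕ) → Mat t (n * n) → Set
Bad p q n t X =
  Σ ℕ λ r → (n * n ≤ r) × (r < t) ×
  Σ (Mat t r) λ X₁ → Σ (Mat r (n * n)) λ X₂ →
    (∀ i j → X i j ≡ (X₁ ⊗ X₂) i j) ×
    Σ ℕ λ s → HasCircuit X₁ s × (s * ⌊log₂ n ⌋ * q < p * (t ∸ r) * (n * n))

-- Let X = X₁X₂ with X₂ ∈ F₂^{r×n²} and X₁ computed by a linear circuit with s gates. Either X has a
-- zero row or two equal rows, or the circuit feeds distinct rows of X from distinct nodes. In the
-- latter case, after relabelling the r inputs, the rows fed directly by inputs are the rows of the
-- relabelled X₂ in order, so X is determined by the circuit (at most (r + s)^{2s} choices), by the
-- row fed by each gate ((t + 1)^s choices) and by X₂ (2^{rn²} choices). When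
-- 72 s ⌊log₂ n⌋ < (t − r) n² (that is, c₀ = 1/72) this is at most 2^{(t − r) n²/2} · 2^{rn²}, which
-- remains a tiny fraction of all 2^{tn²} matrices after summing over r < t and s < tn²; so is the
-- number t² 2^{(t − 1) n²} of matrices with a zero or repeated row.

{-# OPTIONS --safe #-}
module Submission where

open import Defs
open import Algebra.Bundles using (CommutativeRing)
open import Data.Bool using (Bool; true; false; _xor_; _∧_; if_then_else_)
open import Data.Bool.Properties using (xor-comm; ∧-distribʳ-xor; xor-∧-commutativeRing)
open import Data.Fin using (Fin; zero; suc; _≟_; toℕ; punchIn; punchOut)
open import Data.Fin.Properties using (any?; punchIn-punchOut; punchOut-cong; suc-injective)
open import Data.Fin.Permutation as Permutation
  using (Permutation; _⟨$⟩ʳ_; _⟨$⟩ˡ_; inverseˡ; insert; insert-punchIn)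
open import Data.List using (List; []; _∷_; [_]; _++_; map; concatMap; filter; length; allFin; upTo)
open import Data.List.Properties using (length-++; length-map; length-tabulate; length-filter; length-upTo)
open import Data.List.Membership.Propositional using (_∈_; lose)
open import Data.List.Membership.Propositional.Properties
  using (∈-allFin; ∈-map⁺; ∈-filter⁺; ∈-filter⁻; ∈-upTo⁺; ∈-upTo⁻)
open import Data.List.Relation.Unary.Any using (Any; here; there)
import Data.List.Relation.Unary.Any as Any
open import Data.List.Relation.Unary.Any.Properties using (concatMap⁺; map⁺; ++⁺ˡ; ++⁺ʳ)
open import Data.Maybe using (Maybe; just; nothing; is-just; is-nothing; _>>=_)
open import Data.Maybe.Properties using (just-injective)
import Data.Maybe.Properties as Maybe
open import Data.Nat using (ℕ; zero; suc; _+_; _*_; _∸_; _^_; _≤_; _<_; z≤n; s≤s; z<s; s<s; _<?_; >-nonZero)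
open import Data.Nat.Properties hiding (_≟_; suc-injective)
open import Data.Nat.Logarithm using (⌊log₂_⌋; ⌊log₂⌋-mono-≤; ⌊log₂[2^n]⌋≡n)
open import Data.Nat.Solver using (module +-*-Solver)
open import Data.Nat.Tactic.RingSolver using (solve-∀)
open import Data.Product using (Σ; ∃; ∃₂; _×_; _,_; proj₂)
open import Data.Sum using (_⊎_; inj₁; inj₂; map₁)
import Data.Sum.Properties as Sum
open import Data.Vec.Functional using (insertAt; removeAt)
import Data.Vec.Functional as Vector
open import Data.Vec.Functional.Properties using (insertAt-lookup; insertAt-punchIn)
open import Function using (_∘_; _$_; _⇔_; mk⇔; Equivalence)
open import Function.Definitions using (Injective)
open import Relation.Binary.Definitions using (DecidableEquality)
open import Relation.Binary.PropositionalEquality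
  using (_≡_; _≢_; refl; sym; trans; cong; cong₂; subst; module ≡-Reasoning)
open import Relation.Nullary using (yes; no; contradiction)
open import Relation.Nullary.Decidable using (¬?; _×-dec_; decidable-stable)
open import Relation.Unary using (Decidable)
open import Algebra.Properties.CommutativeSemigroup
  (CommutativeRing.+-commutativeSemigroup xor-∧-commutativeRing) using (interchange)
open +-*-Solver using (solve; _:^_; _:*_; _:=_)

private variable
  a b n r s t m : ℕ
  A B : Set

-- Linear circuits over F₂

xorSum-cong : {f g : Fin m → Bool} → (∀ k → f k ≡ g k) → xorSum f ≡ xorSum g
xorSum-cong {zero}  f≗g = refl
xorSum-cong {suc m} f≗g = cong₂ _xor_ (f≗g zero) (xorSum-cong (f≗g ∘ suc))

xorSum-xor : (f g : Fin m → Bool) → xorSum (λ k → f k xor g k) ≡ xorSum f xor xorSum g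
xorSum-xor {zero}  f g = refl
xorSum-xor {suc m} f g = trans (cong ((f zero xor g zero) xor_) (xorSum-xor (f ∘ suc) (g ∘ suc)))
                               (interchange (f zero) (g zero) _ _)

xorSum-false : xorSum {m} (λ _ → false) ≡ false
xorSum-false {zero}  = refl
xorSum-false {suc m} = xorSum-false {m}

xorSum-unitForm : (k : Fin m) (f : Fin m → Bool) → xorSum (λ x → unitForm k x ∧ f x) ≡ f k
xorSum-unitForm {suc m} zero    f = trans (cong (f zero xor_) (xorSum-false {m})) (xor-comm (f zero) false)
xorSum-unitForm {suc m} (suc k) f = trans (xorSum-cong unitForm-suc) (xorSum-unitForm k (f ∘ suc))
  where
  unitForm-suc : ∀ x → unitForm (suc k) (suc x) ∧ f (suc x) ≡ unitForm k x ∧ f (suc x)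
  unitForm-suc x with k ≟ x
  ... | yes _ = refl
  ... | no _  = refl

Row : ℕ → Set
Row m = Fin m → Bool

evalOn : Gates b s → (Fin b → Row m) → Node b s → Row m
evalOn g             Z (inj₁ k)       = Z k
evalOn (g ▷ (u , v)) Z (inj₂ zero)    j = evalOn g Z u j xor evalOn g Z v j
evalOn (g ▷ _)       Z (inj₂ (suc i)) = evalOn g Z (inj₂ i)

outOn : Gates b s → (Fin b → Row m) → Maybe (Node b s) → Row m
outOn g Z (just u) = evalOn g Z u
outOn g Z nothing  = λ _ → false

xorSum-eval : (g : Gates b s) (Z : Fin b → Row m) (u : Node b s) (j : Fin m) →
              xorSum (λ k → eval g u k ∧ Z k j) ≡ evalOn g Z u j
xorSum-eval g             Z (inj₁ k)       j = xorSum-unitForm k (λ x → Z x j)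
xorSum-eval (g ▷ (u , v)) Z (inj₂ zero)    j = begin
  xorSum (λ k → (eval g u k xor eval g v k) ∧ Z k j)
    ≡⟨ xorSum-cong (λ k → ∧-distribʳ-xor (Z k j) (eval g u k) (eval g v k)) ⟩
  xorSum (λ k → eval g u k ∧ Z k j xor eval g v k ∧ Z k j)
    ≡⟨ xorSum-xor (λ k → eval g u k ∧ Z k j) (λ k → eval g v k ∧ Z k j) ⟩
  xorSum (λ k → eval g u k ∧ Z k j) xor xorSum (λ k → eval g v k ∧ Z k j)
    ≡⟨ cong₂ _xor_ (xorSum-eval g Z u j) (xorSum-eval g Z v j) ⟩
  evalOn g Z u j xor evalOn g Z v j
    ∎
  where open ≡-Reasoning
xorSum-eval (g ▷ _)       Z (inj₂ (suc i)) j = xorSum-eval g Z (inj₂ i) j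

xorSum-outForm : (g : Gates b s) (Z : Fin b → Row m) (o : Maybe (Node b s)) (j : Fin m) →
                 xorSum (λ k → outForm g o k ∧ Z k j) ≡ outOn g Z o j
xorSum-outForm         g Z (just u) j = xorSum-eval g Z u j
xorSum-outForm {b = b} g Z nothing  j = xorSum-false {b}

⊗-outOn : (X₁ : Mat t r) (X₂ : Mat r m) (g : Gates r s) (out : Fin t → Maybe (Node r s)) →
          (∀ i k → outForm g (out i) k ≡ X₁ i k) → ∀ x j → (X₁ ⊗ X₂) x j ≡ outOn g X₂ (out x) j
⊗-outOn X₁ X₂ g out computes x j =
  trans (xorSum-cong (λ k → cong (_∧ X₂ k j) (sym (computes x k)))) (xorSum-outForm g X₂ (out x) j)

renameNode : (Fin b → Fin a) → Node b s → Node a s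
renameNode ρ = map₁ ρ

rename : (Fin b → Fin a) → Gates b s → Gates a s
rename ρ []            = []
rename ρ (g ▷ (u , v)) = rename ρ g ▷ (renameNode ρ u , renameNode ρ v)

evalOn-rename : (ρ : Fin b → Fin a) (g : Gates b s) (Z : Fin a → Row m) (u : Node b s) (j : Fin m) →
                evalOn (rename ρ g) Z (renameNode ρ u) j ≡ evalOn g (Z ∘ ρ) u j
evalOn-rename ρ g             Z (inj₁ k)       j = refl
evalOn-rename ρ (g ▷ (u , v)) Z (inj₂ zero)    j =
  cong₂ _xor_ (evalOn-rename ρ g Z u j) (evalOn-rename ρ g Z v j)
evalOn-rename ρ (g ▷ _)       Z (inj₂ (suc i)) j = evalOn-rename ρ g Z (inj₂ i) j

evalOn-cong : (g : Gates b s) {Z Z′ : Fin b → Row m} → (∀ k j → Z k j ≡ Z′ k j) →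
              (u : Node b s) (j : Fin m) → evalOn g Z u j ≡ evalOn g Z′ u j
evalOn-cong g             Z≋Z′ (inj₁ k)       j = Z≋Z′ k j
evalOn-cong (g ▷ (u , v)) Z≋Z′ (inj₂ zero)    j =
  cong₂ _xor_ (evalOn-cong g Z≋Z′ u j) (evalOn-cong g Z≋Z′ v j)
evalOn-cong (g ▷ _)       Z≋Z′ (inj₂ (suc i)) j = evalOn-cong g Z≋Z′ (inj₂ i) j

-- Redundant rows

_≋_ : Mat a b → Mat a b → Set
X ≋ Y = ∀ i j → X i j ≡ Y i j

HasRedundantRow : Mat t m → Set
HasRedundantRow X = (∃ λ i → ∀ j → X i j ≡ false)
                  ⊎ (∃₂ λ i i′ → i ≢ i′ × ∀ j → X i j ≡ X i′ j)

collision-or-injective : DecidableEquality A → (f : Fin n → A) →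
                         (∃₂ λ x y → x ≢ y × f x ≡ f y) ⊎ Injective _≡_ _≡_ f
collision-or-injective _≟ₐ_ f with any? (λ x → any? (λ y → ¬? (x ≟ y) ×-dec (f x ≟ₐ f y)))
... | yes (x , y , x≢y , fx≡fy) = inj₁ (x , y , x≢y , fx≡fy)
... | no ¬collision              = inj₂ λ {x} {y} fx≡fy →
  decidable-stable (x ≟ y) (λ x≢y → ¬collision (x , y , x≢y , fx≡fy))

_≟ₒ_ : DecidableEquality (Maybe (Node r s))
_≟ₒ_ = Maybe.≡-dec (Sum.≡-dec _≟_ _≟_)

redundant-or-injective : (X : Mat t m) (g : Gates r s) (Z : Fin r → Row m) (out : Fin t → Maybe (Node r s)) →
                         (∀ x j → X x j ≡ outOn g Z (out x) j) →
                         HasRedundantRow X ⊎ ((∀ x → out x ≢ nothing) × Injective _≡_ _≡_ out)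
redundant-or-injective X g Z out X≡out with any? (λ x → out x ≟ₒ nothing)
... | yes (x , outx≡nothing) =
  inj₁ (inj₁ (x , λ j → trans (X≡out x j) (cong (λ o → outOn g Z o j) outx≡nothing)))
... | no ¬nothing with collision-or-injective _≟ₒ_ out
...   | inj₁ (x , y , x≢y , outx≡outy) =
  inj₁ (inj₂ (x , y , x≢y , λ j →
    trans (X≡out x j) (trans (cong (λ o → outOn g Z o j) outx≡outy) (sym (X≡out y j)))))
...   | inj₂ injective = inj₂ ((λ x outx≡nothing → ¬nothing (x , outx≡nothing)) , injective)

-- Relabelling inputs in the order of the rows they feed

rank : (Fin t → Bool) → Fin t → ℕ
rank P zero    = 0
rank P (suc x) = if P zero then suc (rank (P ∘ suc) x) else rank (P ∘ suc) x

rank-cong : {P Q : Fin t → Bool} → (∀ x → P x ≡ Q x) → ∀ x → rank P x ≡ rank Q x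
rank-cong P≗Q zero    = refl
rank-cong P≗Q (suc x) rewrite P≗Q zero | rank-cong (P≗Q ∘ suc) x = refl

rank-suc-true : (P : Fin (suc t) → Bool) (x : Fin t) → P zero ≡ true →
                rank P (suc x) ≡ suc (rank (P ∘ suc) x)
rank-suc-true P x P0 rewrite P0 = refl

rank-suc-false : (P : Fin (suc t) → Bool) (x : Fin t) → P zero ≡ false →
                 rank P (suc x) ≡ rank (P ∘ suc) x
rank-suc-false P x P0 rewrite P0 = refl

insert-self : ∀ {m n} (i : Fin (suc m)) (j : Fin (suc n)) (π : Permutation m n) → insert i j π ⟨$⟩ʳ i ≡ j
insert-self i j π with i ≟ i
... | yes _   = refl
... | no i≢i = contradiction refl i≢i

punchOutMaybe : Fin (suc r) → Fin (suc r) → Maybe (Fin r)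
punchOutMaybe k k′ with k ≟ k′
... | yes _   = nothing
... | no k≢k′ = just (punchOut k≢k′)

punchOutMaybe-≢ : {k k′ : Fin (suc r)} (k≢k′ : k ≢ k′) → punchOutMaybe k k′ ≡ just (punchOut k≢k′)
punchOutMaybe-≢ {k = k} {k′} k≢k′ with k ≟ k′
... | yes k≡k′ = contradiction k≡k′ k≢k′
... | no  _    = cong just (punchOut-cong k refl)

punchOutMaybe-just : (k : Fin (suc r)) (o : Maybe (Fin (suc r))) {j : Fin r} →
                     (o >>= punchOutMaybe k) ≡ just j → o ≡ just (punchIn k j)
punchOutMaybe-just k (just k′) eq with k ≟ k′
punchOutMaybe-just k (just k′) refl | no k≢k′ = cong just (sym (punchIn-punchOut k≢k′))

is-just-punchOutMaybe : (k : Fin (suc r)) (o : Maybe (Fin (suc r))) →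
                        o ≢ just k → is-just (o >>= punchOutMaybe k) ≡ is-just o
is-just-punchOutMaybe k nothing   o≢k = refl
is-just-punchOutMaybe k (just k′) o≢k with k ≟ k′
... | yes refl = contradiction refl o≢k
... | no  _    = refl

InjectiveOnJust : (Fin t → Maybe A) → Set
InjectiveOnJust ι = ∀ {x y k} → ι x ≡ just k → ι y ≡ just k → x ≡ y

-- If row 0 is fed by input k, σ sends k to 0 and acts elsewhere as the permutation obtained
-- recursively for the remaining rows, with k punched out of the inputs.
rankingPermutation : (ι : Fin t → Maybe (Fin r)) → InjectiveOnJust ι →
                     Σ (Permutation r r) λ σ →
                       ∀ {x k} → ι x ≡ just k → toℕ (σ ⟨$⟩ʳ k) ≡ rank (is-just ∘ ι) x
rankingPermutation {zero}  {r}     ι ι-inj = Permutation.id , λ { {x = ()} }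
rankingPermutation {suc t} {zero}  ι ι-inj = Permutation.id , λ { {k = ()} }
rankingPermutation {suc t} {suc r} ι ι-inj with ι zero in ι0
... | nothing with rankingPermutation (ι ∘ suc) (λ ιx≡k ιy≡k → suc-injective (ι-inj ιx≡k ιy≡k))
...   | σ , σ-rank = σ , rank-σ
  where
  rank-σ : ∀ {x k} → ι x ≡ just k → toℕ (σ ⟨$⟩ʳ k) ≡ rank (is-just ∘ ι) x
  rank-σ {zero}  ιx≡k = contradiction (trans (sym ι0) ιx≡k) λ ()
  rank-σ {suc x} ιx≡k = trans (σ-rank ιx≡k) (sym (rank-suc-false (is-just ∘ ι) x (cong is-just ι0)))
rankingPermutation {suc t} {suc r} ι ι-inj | just k
  with rankingPermutation (λ x → ι (suc x) >>= punchOutMaybe k) ι′-injective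
  where
  ι′-injective : InjectiveOnJust (λ x → ι (suc x) >>= punchOutMaybe k)
  ι′-injective ιx≡j ιy≡j =
    suc-injective (ι-inj (punchOutMaybe-just k _ ιx≡j) (punchOutMaybe-just k _ ιy≡j))
... | σ′ , σ′-rank = σ , rank-σ
  where
  σ : Permutation (suc r) (suc r)
  σ = insert k zero σ′

  ι-suc≢k : ∀ x → ι (suc x) ≢ just k
  ι-suc≢k x ιx≡k = contradiction (ι-inj ι0 ιx≡k) λ ()

  rank-ι′ : ∀ x → rank (λ y → is-just (ι (suc y) >>= punchOutMaybe k)) x ≡ rank (is-just ∘ ι ∘ suc) x
  rank-ι′ = rank-cong (λ y → is-just-punchOutMaybe k (ι (suc y)) (ι-suc≢k y))

  rank-σ : ∀ {x k′} → ι x ≡ just k′ → toℕ (σ ⟨$⟩ʳ k′) ≡ rank (is-just ∘ ι) x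
  rank-σ {zero}  ιx≡k′ =
    trans (cong (toℕ ∘ (σ ⟨$⟩ʳ_)) (just-injective (trans (sym ιx≡k′) ι0)))
          (cong toℕ (insert-self k zero σ′))
  rank-σ {suc x} {k′} ιx≡k′ = begin
    toℕ (σ ⟨$⟩ʳ k′)
      ≡⟨ cong (toℕ ∘ (σ ⟨$⟩ʳ_)) (punchIn-punchOut k≢k′) ⟨
    toℕ (σ ⟨$⟩ʳ punchIn k (punchOut k≢k′))
      ≡⟨ cong toℕ (insert-punchIn k zero σ′ (punchOut k≢k′)) ⟩
    suc (toℕ (σ′ ⟨$⟩ʳ punchOut k≢k′))
      ≡⟨ cong suc (σ′-rank (trans (cong (_>>= punchOutMaybe k) ιx≡k′) (punchOutMaybe-≢ k≢k′))) ⟩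
    suc (rank (λ y → is-just (ι (suc y) >>= punchOutMaybe k)) x)
      ≡⟨ cong suc (rank-ι′ x) ⟩
    suc (rank (is-just ∘ ι ∘ suc) x)
      ≡⟨ rank-suc-true (is-just ∘ ι) x (cong is-just ι0) ⟨
    rank (is-just ∘ ι) (suc x)
      ∎
    where
    open ≡-Reasoning
    k≢k′ : k ≢ k′
    k≢k′ k≡k′ = ι-suc≢k x (trans ιx≡k′ (cong just (sym k≡k′)))

-- Decoding

preimage : DecidableEquality A → (Fin n → A) → A → Maybe (Fin n)
preimage _≟ₐ_ f y with any? (λ x → f x ≟ₐ y)
... | yes (x , _) = just x
... | no _        = nothing

preimage-just : (_≟ₐ_ : DecidableEquality A) (f : Fin n → A) {y : A} {x : Fin n} →
                preimage _≟ₐ_ f y ≡ just x → f x ≡ y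
preimage-just _≟ₐ_ f {y} eq with any? (λ x → f x ≟ₐ y)
preimage-just _≟ₐ_ f refl | yes (x , fx≡y) = fx≡y

preimage-nothing : (_≟ₐ_ : DecidableEquality A) (f : Fin n → A) {y : A} {x : Fin n} →
                   preimage _≟ₐ_ f y ≡ nothing → f x ≢ y
preimage-nothing _≟ₐ_ f {y} eq fx≡y with any? (λ x → f x ≟ₐ y)
preimage-nothing _≟ₐ_ f ()  fx≡y | yes _
preimage-nothing _≟ₐ_ f eq  fx≡y | no ¬∃ = ¬∃ (_ , fx≡y)

lookupOr : A → (Fin r → A) → ℕ → A
lookupOr {r = zero}  a f c       = a
lookupOr {r = suc r} a f zero    = f zero
lookupOr {r = suc r} a f (suc c) = lookupOr a (f ∘ suc) c

lookupOr-toℕ : (a : A) (f : Fin r → A) (k : Fin r) → lookupOr a f (toℕ k) ≡ f k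
lookupOr-toℕ a f zero    = refl
lookupOr-toℕ a f (suc k) = lookupOr-toℕ a (f ∘ suc) k

_≟ₘ_ : DecidableEquality (Maybe (Fin t))
_≟ₘ_ = Maybe.≡-dec _≟_

IsGateRows : (Fin t → Maybe (Node r s)) → (Fin s → Maybe (Fin t)) → Set
IsGateRows out w = ∀ {j x} → (w j ≡ just x) ⇔ (out x ≡ just (inj₂ j))

gateRows : (Fin t → Maybe (Node r s)) → Fin s → Maybe (Fin t)
gateRows out j = preimage _≟ₒ_ out (just (inj₂ j))

gateRows-isGateRows : (out : Fin t → Maybe (Node r s)) → Injective _≡_ _≡_ out →
                      IsGateRows out (gateRows out)
gateRows-isGateRows out injective {j} {x} = mk⇔ (preimage-just _≟ₒ_ out) from
  where
  from : out x ≡ just (inj₂ j) → gateRows out j ≡ just x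
  from outx with gateRows out j in pre
  ... | just x′ = cong just (injective (trans (preimage-just _≟ₒ_ out pre) (sym outx)))
  ... | nothing = contradiction outx (preimage-nothing _≟ₒ_ out pre)

isInputRow : (Fin s → Maybe (Fin t)) → Fin t → Bool
isInputRow w x = is-nothing (preimage _≟ₘ_ w (just x))

-- The rows fed by no gate are the rows of Z in order; decode-correct only reads indices below r,
-- so the default row of lookupOr never occurs.
decode : Gates r s → (Fin s → Maybe (Fin t)) → (Fin r → Row m) → Mat t m
decode g w Z x with preimage _≟ₘ_ w (just x)
... | just j  = evalOn g Z (inj₂ j)
... | nothing = lookupOr (λ _ → false) Z (rank (isInputRow w) x)

inputOf : Maybe (Node r s) → Maybe (Fin r)
inputOf (just (inj₁ k)) = just k
inputOf (just (inj₂ _)) = nothing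
inputOf nothing         = nothing

inputOf-just : (o : Maybe (Node r s)) {k : Fin r} → inputOf o ≡ just k → o ≡ just (inj₁ k)
inputOf-just (just (inj₁ k)) refl = refl

module _ {out : Fin t → Maybe (Node r s)} {w : Fin s → Maybe (Fin t)}
         (gate-rows : IsGateRows out w) (total : ∀ x → out x ≢ nothing) where

  classifyRow : ∀ x → (∃ λ j → preimage _≟ₘ_ w (just x) ≡ just j × out x ≡ just (inj₂ j))
                    ⊎ (∃ λ k → preimage _≟ₘ_ w (just x) ≡ nothing × out x ≡ just (inj₁ k))
  classifyRow x with preimage _≟ₘ_ w (just x) in pre
  ... | just j  = inj₁ (j , refl , Equivalence.to gate-rows (preimage-just _≟ₘ_ w pre))
  ... | nothing with out x in outx
  ...   | nothing       = contradiction outx (total x)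
  ...   | just (inj₂ j) = contradiction (Equivalence.from gate-rows outx) (preimage-nothing _≟ₘ_ w pre)
  ...   | just (inj₁ k) = inj₂ (k , refl , refl)

  isInputRow-inputOf : ∀ x → isInputRow w x ≡ is-just (inputOf (out x))
  isInputRow-inputOf x with classifyRow x
  ... | inj₁ (j , pre , outx) rewrite pre | outx = refl
  ... | inj₂ (k , pre , outx) rewrite pre | outx = refl

-- σ is chosen before w and Z′, so that any pointwise equal copies of them, such as those found in an
-- enumeration, decode X as well.
decode-correct : (X : Mat t m) (g : Gates r s) (Z : Fin r → Row m) (out : Fin t → Maybe (Node r s)) →
                 (∀ x j → X x j ≡ outOn g Z (out x) j) → (∀ x → out x ≢ nothing) →
                 Injective _≡_ _≡_ out →
                 Σ (Permutation r r) λ σ →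
                   ∀ {w Z′} → IsGateRows out w → (∀ k j → Z′ (σ ⟨$⟩ʳ k) j ≡ Z k j) →
                   decode (rename (σ ⟨$⟩ʳ_) g) w Z′ ≋ X
decode-correct X g Z out X≡out total injective
  with rankingPermutation (inputOf ∘ out)
         (λ ιx≡k ιy≡k → injective (trans (inputOf-just _ ιx≡k) (sym (inputOf-just _ ιy≡k))))
... | σ , σ-rank = σ , correct
  where
  correct : ∀ {w Z′} → IsGateRows out w → (∀ k j → Z′ (σ ⟨$⟩ʳ k) j ≡ Z k j) →
            decode (rename (σ ⟨$⟩ʳ_) g) w Z′ ≋ X
  correct {w} {Z′} gate-rows Z′∘σ≋Z x j with classifyRow gate-rows total x
  ... | inj₁ (i , pre , outx) rewrite pre = begin
    evalOn (rename (σ ⟨$⟩ʳ_) g) Z′ (inj₂ i) j  ≡⟨ evalOn-rename (σ ⟨$⟩ʳ_) g Z′ (inj₂ i) j ⟩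
    evalOn g (Z′ ∘ (σ ⟨$⟩ʳ_)) (inj₂ i) j      ≡⟨ evalOn-cong g Z′∘σ≋Z (inj₂ i) j ⟩
    outOn g Z (just (inj₂ i)) j               ≡⟨ cong (λ o → outOn g Z o j) outx ⟨
    outOn g Z (out x) j                       ≡⟨ X≡out x j ⟨
    X x j                                     ∎
    where open ≡-Reasoning
  ... | inj₂ (k , pre , outx) rewrite pre = begin
    lookupOr (λ _ → false) Z′ (rank (isInputRow w) x) j
      ≡⟨ cong (λ c → lookupOr (λ _ → false) Z′ c j) (rank-cong (isInputRow-inputOf gate-rows total) x) ⟩
    lookupOr (λ _ → false) Z′ (rank (is-just ∘ inputOf ∘ out) x) j
      ≡⟨ cong (λ c → lookupOr (λ _ → false) Z′ c j) (σ-rank (cong inputOf outx)) ⟨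
    lookupOr (λ _ → false) Z′ (toℕ (σ ⟨$⟩ʳ k)) j
      ≡⟨ cong (_$ j) (lookupOr-toℕ (λ _ → false) Z′ (σ ⟨$⟩ʳ k)) ⟩
    Z′ (σ ⟨$⟩ʳ k) j
      ≡⟨ Z′∘σ≋Z k j ⟩
    outOn g Z (just (inj₁ k)) j
      ≡⟨ cong (λ o → outOn g Z o j) outx ⟨
    outOn g Z (out x) j
      ≡⟨ X≡out x j ⟨
    X x j
      ∎
    where open ≡-Reasoning

-- Enumerations

length-concatMap-*-≤ : {c d : ℕ} (f : A → List B) (xs : List A) →
                       (∀ {x} → x ∈ xs → length (f x) * c ≤ d) → length (concatMap f xs) * c ≤ length xs * d
length-concatMap-*-≤         f []       bound = z≤n
length-concatMap-*-≤ {c = c} f (x ∷ xs) bound = begin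
  length (f x ++ concatMap f xs) * c              ≡⟨ cong (_* c) (length-++ (f x)) ⟩
  (length (f x) + length (concatMap f xs)) * c    ≡⟨ *-distribʳ-+ c (length (f x)) _ ⟩
  length (f x) * c + length (concatMap f xs) * c  ≤⟨ +-mono-≤ (bound (here refl))
                                                              (length-concatMap-*-≤ f xs (bound ∘ there)) ⟩
  _ + length xs * _                               ∎
  where open ≤-Reasoning

length-concatMap-≤ : {d : ℕ} (f : A → List B) (xs : List A) → (∀ x → length (f x) ≤ d) →
                     length (concatMap f xs) ≤ length xs * d
length-concatMap-≤ f xs bound = subst (_≤ _) (*-identityʳ _)
  (length-concatMap-*-≤ f xs λ {x} _ → subst (_≤ _) (sym (*-identityʳ _)) (bound x))

functions : List A → (n : ℕ) → List (Fin n → A)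
functions xs zero    = [ Vector.[] ]
functions xs (suc n) = concatMap (λ x → map (x Vector.∷_) (functions xs n)) xs

length-functions : (xs : List A) (n : ℕ) → length (functions xs n) ≤ length xs ^ n
length-functions xs zero    = ≤-refl
length-functions xs (suc n) = length-concatMap-≤ _ xs λ x →
  subst (_≤ _) (sym (length-map (x Vector.∷_) (functions xs n))) (length-functions xs n)

functions-complete : {R : A → B → Set} (xs : List A) → (∀ y → Any (λ x → R x y) xs) →
                     {n : ℕ} (f : Fin n → B) → Any (λ h → ∀ i → R (h i) (f i)) (functions xs n)
functions-complete xs covers {zero}  f = here λ ()
functions-complete xs covers {suc n} f = concatMap⁺ _ (Any.map cons (covers (f zero)))
  where
  cons : ∀ {x} → _ → Any _ (map (x Vector.∷_) (functions xs n))
  cons Rx = map⁺ (Any.map (λ Rh → λ { zero → Rx ; (suc i) → Rh i })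
                          (functions-complete xs covers (f ∘ suc)))

bits : List Bool
bits = false ∷ true ∷ []

bits-complete : ∀ x → Any (_≡ x) bits
bits-complete false = here refl
bits-complete true  = there (here refl)

matrices : (a b : ℕ) → List (Mat a b)
matrices a b = functions (functions bits b) a

length-matrices : (a b : ℕ) → length (matrices a b) ≤ (2 ^ b) ^ a
length-matrices a b = ≤-trans (length-functions (functions bits b) a) (^-monoˡ-≤ a (length-functions bits b))

matrices-complete : (X : Mat a b) → Any (_≋ X) (matrices a b)
matrices-complete X = functions-complete _ (functions-complete bits bits-complete) X

length-allFin : (n : ℕ) → length (allFin n) ≡ n
length-allFin n = length-tabulate {n = n} (λ i → i)

allMaybeFin : (t : ℕ) → List (Maybe (Fin t))
allMaybeFin t = nothing ∷ map just (allFin t)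

∈-allMaybeFin : (o : Maybe (Fin t)) → o ∈ allMaybeFin t
∈-allMaybeFin nothing  = here refl
∈-allMaybeFin (just x) = there (∈-map⁺ just (∈-allFin x))

length-allMaybeFin : (t : ℕ) → length (allMaybeFin t) ≡ suc t
length-allMaybeFin t = cong suc (trans (length-map just (allFin t)) (length-allFin t))

allNode : (r s : ℕ) → List (Node r s)
allNode r s = map inj₁ (allFin r) ++ map inj₂ (allFin s)

∈-allNode : (u : Node r s) → u ∈ allNode r s
∈-allNode     (inj₁ k) = ++⁺ˡ (∈-map⁺ inj₁ (∈-allFin k))
∈-allNode {r} (inj₂ j) = ++⁺ʳ (map inj₁ (allFin r)) (∈-map⁺ inj₂ (∈-allFin j))

length-allNode : (r s : ℕ) → length (allNode r s) ≡ r + s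
length-allNode r s = begin
  length (map inj₁ (allFin r) ++ map inj₂ (allFin s))
    ≡⟨ length-++ (map inj₁ (allFin r)) ⟩
  length (map inj₁ (allFin r)) + length (map inj₂ (allFin s))
    ≡⟨ cong₂ _+_ (length-map inj₁ (allFin r)) (length-map inj₂ (allFin s)) ⟩
  length (allFin r) + length (allFin s)
    ≡⟨ cong₂ _+_ (length-allFin r) (length-allFin s) ⟩
  r + s
    ∎
  where open ≡-Reasoning

allGates : (r s : ℕ) → List (Gates r s)
allGates r zero    = [ [] ]
allGates r (suc s) =
  concatMap (λ g → concatMap (λ u → map (λ v → g ▷ (u , v)) (allNode r s)) (allNode r s)) (allGates r s)

∈-allGates : (g : Gates r s) → g ∈ allGates r s
∈-allGates []            = here refl
∈-allGates (g ▷ (u , v)) =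
  concatMap⁺ _ (lose (∈-allGates g) (concatMap⁺ _ (lose (∈-allNode u) (∈-map⁺ _ (∈-allNode v)))))

length-allGates : (r s : ℕ) {B : ℕ} → r + s ≤ B → length (allGates r s) ≤ B ^ (2 * s)
length-allGates r zero        r+s≤B = ≤-refl
length-allGates r (suc s) {B} r+s≤B = begin
  length (allGates r (suc s))
    ≤⟨ length-concatMap-≤ _ (allGates r s) (λ g → length-concatMap-≤ _ (allNode r s) λ u →
         ≤-reflexive (trans (length-map _ (allNode r s)) (length-allNode r s))) ⟩
  length (allGates r s) * (length (allNode r s) * (r + s))
    ≡⟨ cong (λ l → length (allGates r s) * (l * (r + s))) (length-allNode r s) ⟩
  length (allGates r s) * ((r + s) * (r + s))
    ≤⟨ *-mono-≤ (length-allGates r s r+s≤B′) (*-mono-≤ r+s≤B′ r+s≤B′) ⟩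
  B ^ (2 * s) * (B * B)
    ≡⟨ trans (*-comm _ (B * B)) (*-assoc B B _) ⟩
  B ^ (2 + 2 * s)
    ≡⟨ cong (B ^_) (*-suc 2 s) ⟨
  B ^ (2 * suc s)
    ∎
  where
  open ≤-Reasoning
  r+s≤B′ : r + s ≤ B
  r+s≤B′ = ≤-trans (+-monoʳ-≤ r (n≤1+n s)) r+s≤B

-- Lists covering the bad matrices

decodings : (t r s m : ℕ) → List (Mat t m)
decodings t r s m =
  concatMap (λ g → concatMap (λ w → map (decode g w) (matrices r m)) (functions (allMaybeFin t) s))
            (allGates r s)

length-decodings : (t r s m : ℕ) {B : ℕ} → r + s ≤ B →
                   length (decodings t r s m) ≤ B ^ (2 * s) * (suc t ^ s * (2 ^ m) ^ r)
length-decodings t r s m r+s≤B =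
  ≤-trans (length-concatMap-≤ _ (allGates r s) λ g → length-concatMap-≤ _ (functions (allMaybeFin t) s) λ w →
             ≤-trans (≤-reflexive (length-map (decode g w) (matrices r m))) (length-matrices r m))
          (*-mono-≤ (length-allGates r s r+s≤B)
                    (*-monoˡ-≤ _ (subst (λ l → length (functions (allMaybeFin t) s) ≤ l ^ s) (length-allMaybeFin t)
                                        (length-functions (allMaybeFin t) s))))

decodings-complete : (X : Mat t m) (g : Gates r s) (Z : Fin r → Row m) (out : Fin t → Maybe (Node r s)) →
                     (∀ x j → X x j ≡ outOn g Z (out x) j) → (∀ x → out x ≢ nothing) →
                     Injective _≡_ _≡_ out → Any (_≋ X) (decodings t r s m)
decodings-complete {t} {m} {r} X g Z out X≡out total injective with decode-correct X g Z out X≡out total injective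
... | σ , correct = concatMap⁺ _ (lose (∈-allGates (rename (σ ⟨$⟩ʳ_) g)) (concatMap⁺ _ (Any.map withGateRows
        (functions-complete (allMaybeFin t) (λ o → Any.map sym (∈-allMaybeFin o)) (gateRows out)))))
  where
  gate-rows = gateRows-isGateRows out injective

  withGateRows : ∀ {w} → (∀ j → w j ≡ gateRows out j) →
                 Any (_≋ X) (map (decode (rename (σ ⟨$⟩ʳ_) g) w) (matrices r m))
  withGateRows {w} w≗ = map⁺ (Any.map (λ Z′≋ → correct w-rows λ k j →
                                          trans (Z′≋ (σ ⟨$⟩ʳ k) j) (cong (λ z → Z z j) (inverseˡ σ)))
                                      (matrices-complete (λ k → Z (σ ⟨$⟩ˡ k))))
    where
    w-rows : IsGateRows out w
    w-rows = mk⇔ (λ wj≡x → Equivalence.to gate-rows (trans (sym (w≗ _)) wj≡x))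
                 (λ outx → trans (w≗ _) (Equivalence.from gate-rows outx))

extraRow : Maybe (Fin t) → Mat t m → Row m
extraRow nothing  Y = λ _ → false
extraRow (just c) Y = Y c

rowInsertions : Fin (suc t) → Maybe (Fin t) → List (Mat (suc t) m)
rowInsertions {t} {m} i c = map (λ Y → insertAt Y i (extraRow c Y)) (matrices t m)

redundantRowMatrices : (t m : ℕ) → List (Mat t m)
redundantRowMatrices zero    m = []
redundantRowMatrices (suc t) m = concatMap (λ i → concatMap (rowInsertions i) (allMaybeFin t)) (allFin (suc t))

length-redundantRowMatrices : (t m : ℕ) →
                              length (redundantRowMatrices (suc t) m) ≤ suc t * (suc t * (2 ^ m) ^ t)
length-redundantRowMatrices t m =
  ≤-trans (length-concatMap-≤ (λ i → concatMap (rowInsertions i) (allMaybeFin t)) (allFin (suc t)) λ i →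
             length-concatMap-≤ (rowInsertions i) (allMaybeFin t) λ c →
             ≤-trans (≤-reflexive (length-map _ (matrices t m))) (length-matrices t m))
          (≤-reflexive (cong₂ (λ a b → a * (b * (2 ^ m) ^ t)) (length-allFin (suc t)) (length-allMaybeFin t)))

insertAt-≋ : (X : Mat (suc t) m) (i : Fin (suc t)) {Y : Mat t m} {v : Row m} →
             (∀ y j → Y y j ≡ X (punchIn i y) j) → (∀ j → v j ≡ X i j) → insertAt Y i v ≋ X
insertAt-≋ X i {Y} {v} Y≋ v≗ x j with i ≟ x
... | yes refl = trans (cong (_$ j) (insertAt-lookup Y i v)) (v≗ j)
... | no i≢x   = begin
  insertAt Y i v x j                           ≡⟨ cong (λ z → insertAt Y i v z j) (punchIn-punchOut i≢x) ⟨
  insertAt Y i v (punchIn i (punchOut i≢x)) j  ≡⟨ cong (_$ j) (insertAt-punchIn Y i v (punchOut i≢x)) ⟩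
  Y (punchOut i≢x) j                           ≡⟨ Y≋ (punchOut i≢x) j ⟩
  X (punchIn i (punchOut i≢x)) j               ≡⟨ cong (λ z → X z j) (punchIn-punchOut i≢x) ⟩
  X x j                                        ∎
  where open ≡-Reasoning

redundantRowMatrices-insert : (X : Mat (suc t) m) (i : Fin (suc t)) (c : Maybe (Fin t)) →
                         (∀ Y → Y ≋ removeAt X i → ∀ j → extraRow c Y j ≡ X i j) →
                         Any (_≋ X) (redundantRowMatrices (suc t) m)
redundantRowMatrices-insert X i c extraRow≗ =
  concatMap⁺ _ (lose (∈-allFin i) (concatMap⁺ _ (lose (∈-allMaybeFin c)
    (map⁺ (Any.map (λ {Y} Y≋ → insertAt-≋ X i Y≋ (extraRow≗ Y Y≋))
                   (matrices-complete (removeAt X i)))))))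

redundantRowMatrices-complete : (X : Mat t m) → HasRedundantRow X → Any (_≋ X) (redundantRowMatrices t m)
redundantRowMatrices-complete {suc t} X (inj₁ (i , Xi≡0)) =
  redundantRowMatrices-insert X i nothing λ Y _ j → sym (Xi≡0 j)
redundantRowMatrices-complete {suc t} X (inj₂ (i , i′ , i≢i′ , Xi≡Xi′)) =
  redundantRowMatrices-insert X i (just (punchOut i≢i′)) λ Y Y≋ j →
    trans (Y≋ (punchOut i≢i′) j) (trans (cong (λ z → X z j) (punchIn-punchOut i≢i′)) (sym (Xi≡Xi′ j)))

Cheap : (n t r s : ℕ) → Set
Cheap n t r s = s * ⌊log₂ n ⌋ * 72 < 1 * (t ∸ r) * (n * n)

cheap? : ∀ n t r → Decidable (Cheap n t r)
cheap? n t r s = s * ⌊log₂ n ⌋ * 72 <? 1 * (t ∸ r) * (n * n)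

cheapDecodingsAt : (n t r : ℕ) → List (Mat t (n * n))
cheapDecodingsAt n t r = concatMap (λ s → decodings t r s (n * n)) (filter (cheap? n t r) (upTo (t * (n * n))))

cheapDecodings : (n t : ℕ) → List (Mat t (n * n))
cheapDecodings n t = concatMap (cheapDecodingsAt n t) (upTo t)

badCover : (n t : ℕ) → List (Mat t (n * n))
badCover n t = redundantRowMatrices t (n * n) ++ cheapDecodings n t

1≤⌊log₂n⌋ : 2 ≤ n → 1 ≤ ⌊log₂ n ⌋
1≤⌊log₂n⌋ 2≤n = ≤-trans (≤-reflexive (sym (⌊log₂[2^n]⌋≡n 1))) (⌊log₂⌋-mono-≤ 2≤n)

cheap⇒s<tn² : 2 ≤ n → Cheap n t r s → s < t * (n * n)
cheap⇒s<tn² {n} {t} {r} {s} 2≤n cheap = begin-strict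
  s                      ≤⟨ m≤m*n s ⌊log₂ n ⌋ {{>-nonZero (1≤⌊log₂n⌋ 2≤n)}} ⟩
  s * ⌊log₂ n ⌋          ≤⟨ m≤m*n (s * ⌊log₂ n ⌋) 72 ⟩
  s * ⌊log₂ n ⌋ * 72     <⟨ cheap ⟩
  1 * (t ∸ r) * (n * n)  ≡⟨ cong (_* (n * n)) (*-identityˡ (t ∸ r)) ⟩
  (t ∸ r) * (n * n)      ≤⟨ *-monoˡ-≤ (n * n) (m∸n≤m t r) ⟩
  t * (n * n)            ∎
  where open ≤-Reasoning

cheapCircuit-∈-badCover : 2 ≤ n → (X : Mat t (n * n)) (g : Gates r s) (Z : Fin r → Row (n * n))
                          (out : Fin t → Maybe (Node r s)) → (∀ x j → X x j ≡ outOn g Z (out x) j) →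
                          r < t → Cheap n t r s → Any (_≋ X) (badCover n t)
cheapCircuit-∈-badCover {n} {t} {r} {s} 2≤n X g Z out rows r<t cheap with redundant-or-injective X g Z out rows
... | inj₁ redundant           = ++⁺ˡ (redundantRowMatrices-complete X redundant)
... | inj₂ (total , injective) = ++⁺ʳ (redundantRowMatrices t (n * n))
  (concatMap⁺ (cheapDecodingsAt n t) (lose (∈-upTo⁺ r<t) (concatMap⁺ (λ s → decodings t r s (n * n))
      (lose {x = s} (∈-filter⁺ (cheap? n t r) (∈-upTo⁺ (cheap⇒s<tn² {n} {t} {r} {s} 2≤n cheap)) cheap)
        (decodings-complete X g Z out rows total injective)))))

badCover-complete : 2 ≤ n → (X : Mat t (n * n)) → Bad 1 72 n t X → Any (_≋ X) (badCover n t)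
badCover-complete 2≤n X (r , _ , r<t , X₁ , X₂ , X≡X₁X₂ , s , (g , out , computes) , cheap) =
  cheapCircuit-∈-badCover 2≤n X g X₂ out (λ x j → trans (X≡X₁X₂ x j) (⊗-outOn X₁ X₂ g out computes x j))
                          r<t cheap

-- Counting

n<2^n : ∀ n → n < 2 ^ n
n<2^n zero    = z<s
n<2^n (suc n) = begin-strict
  suc n          <⟨ s<s (n<2^n n) ⟩
  suc (2 ^ n)    ≤⟨ +-monoˡ-≤ (2 ^ n) (m^n>0 2 n) ⟩
  2 ^ n + 2 ^ n  ≡⟨ cong (2 ^ n +_) (+-identityʳ (2 ^ n)) ⟨
  2 ^ suc n      ∎
  where open ≤-Reasoning

n<2^[1+⌊log₂n⌋] : ∀ n → n < 2 ^ suc ⌊log₂ n ⌋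
n<2^[1+⌊log₂n⌋] n = ≰⇒> λ 2^[1+L]≤n → <-irrefl refl (begin-strict
  ⌊log₂ n ⌋                    <⟨ n<1+n _ ⟩
  suc ⌊log₂ n ⌋                ≡⟨ ⌊log₂[2^n]⌋≡n (suc ⌊log₂ n ⌋) ⟨
  ⌊log₂ (2 ^ suc ⌊log₂ n ⌋) ⌋  ≤⟨ ⌊log₂⌋-mono-≤ 2^[1+L]≤n ⟩
  ⌊log₂ n ⌋                    ∎)
  where open ≤-Reasoning

t≤n³ : 1 ≤ n → t ^ 100 < n ^ 281 → t ≤ n ^ 3
t≤n³ {n} {t} 1≤n t¹⁰⁰<n²⁸¹ = ≮⇒≥ λ n³<t → <-irrefl refl (begin-strict
  n ^ 281        ≤⟨ ^-monoʳ-≤ n {{>-nonZero 1≤n}} (m≤m+n 281 19) ⟩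
  n ^ 300        ≡⟨ ^-*-assoc n 3 100 ⟨
  (n ^ 3) ^ 100  ≤⟨ ^-monoˡ-≤ 100 (<⇒≤ n³<t) ⟩
  t ^ 100        <⟨ t¹⁰⁰<n²⁸¹ ⟩
  n ^ 281        ∎)
  where open ≤-Reasoning

large⇒2≤n : ∀ {k} → 2 * k + 18 ≤ n → 2 ≤ n
large⇒2≤n {k = k} n-large = ≤-trans (≤-trans (s≤s (s≤s z≤n)) (m≤n+m 18 (2 * k))) n-large

length-redundantRowMatrices-* : (t m : ℕ) {d : ℕ} → d * (t * t) ≤ 2 ^ m →
                                length (redundantRowMatrices t m) * d ≤ 2 ^ (t * m)
length-redundantRowMatrices-* zero    m     dt²≤2^m = z≤n
length-redundantRowMatrices-* (suc t) m {d} dt²≤2^m = begin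
  length (redundantRowMatrices (suc t) m) * d  ≤⟨ *-monoˡ-≤ d (length-redundantRowMatrices t m) ⟩
  suc t * (suc t * P) * d                      ≡⟨ regroup (suc t) P d ⟩
  P * (d * (suc t * suc t))                    ≤⟨ *-monoʳ-≤ P dt²≤2^m ⟩
  P * 2 ^ m                                    ≡⟨ *-comm P (2 ^ m) ⟩
  (2 ^ m) ^ suc t                              ≡⟨ ^-*-assoc 2 m (suc t) ⟩
  2 ^ (m * suc t)                              ≡⟨ cong (2 ^_) (*-comm m (suc t)) ⟩
  2 ^ (suc t * m)                              ∎
  where
  open ≤-Reasoning
  P = (2 ^ m) ^ t
  regroup : ∀ u p d → u * (u * p) * d ≡ p * (d * (u * u))
  regroup = solve-∀

module Counting {k n t : ℕ} (n-large : 2 * k + 18 ≤ n) (n²≤t : n * n ≤ t) (t≤n³ : t ≤ n ^ 3) where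

  open ≤-Reasoning

  n² L c overhead : ℕ
  n² = n * n
  L  = ⌊log₂ n ⌋
  c  = suc k + n * 8
  -- 2k times the number t · tn² of pairs (r, s) with r < t and s < tn²
  overhead = 2 * k * (t * (t * n²))

  2≤n : 2 ≤ n
  2≤n = large⇒2≤n {k = k} n-large

  1≤n : 1 ≤ n
  1≤n = ≤-trans (s≤s z≤n) 2≤n

  1≤n² : 1 ≤ n²
  1≤n² = *-mono-≤ 1≤n 1≤n

  1≤t : 1 ≤ t
  1≤t = ≤-trans 1≤n² n²≤t

  1≤L : 1 ≤ L
  1≤L = 1≤⌊log₂n⌋ 2≤n

  overhead≤2^c : overhead ≤ 2 ^ c
  overhead≤2^c = begin
    2 * k * (t * (t * n²))              ≤⟨ *-mono-≤ (*-monoʳ-≤ 2 (<⇒≤ (n<2^n k)))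
                                                    (*-mono-≤ t≤n³ (*-monoˡ-≤ n² t≤n³)) ⟩
    2 ^ suc k * (n ^ 3 * (n ^ 3 * n²))  ≡⟨ cong (2 ^ suc k *_) (n³n³n²≡n⁸ n) ⟩
    2 ^ suc k * n ^ 8                   ≤⟨ *-monoʳ-≤ (2 ^ suc k) (^-monoˡ-≤ 8 (<⇒≤ (n<2^n n))) ⟩
    2 ^ suc k * (2 ^ n) ^ 8             ≡⟨ cong (2 ^ suc k *_) (^-*-assoc 2 n 8) ⟩
    2 ^ suc k * 2 ^ (n * 8)             ≡⟨ ^-distribˡ-+-* 2 (suc k) (n * 8) ⟨
    2 ^ c                               ∎
    where
    n³n³n²≡n⁸ : ∀ n → n ^ 3 * (n ^ 3 * (n * n)) ≡ n ^ 8
    n³n³n²≡n⁸ = solve 1 (λ n → n :^ 3 :* (n :^ 3 :* (n :* n)) := n :^ 8) refl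

  2c≤n² : 2 * c ≤ n²
  2c≤n² = begin
    2 * (suc k + n * 8)       ≡⟨ regroup k n ⟩
    (2 * k + 2) + n * 16      ≤⟨ +-monoˡ-≤ (n * 16) (m≤n*m (2 * k + 2) n {{>-nonZero 1≤n}}) ⟩
    n * (2 * k + 2) + n * 16  ≡⟨ *-distribˡ-+ n (2 * k + 2) 16 ⟨
    n * (2 * k + 2 + 16)      ≡⟨ cong (n *_) (+-assoc (2 * k) 2 16) ⟩
    n * (2 * k + 18)          ≤⟨ *-monoʳ-≤ n n-large ⟩
    n * n                     ∎
    where
    regroup : ∀ k n → 2 * (1 + k + n * 8) ≡ (2 * k + 2) + n * 16
    regroup = solve-∀

  2kt²≤2^n² : 2 * k * (t * t) ≤ 2 ^ n²
  2kt²≤2^n² = begin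
    2 * k * (t * t)  ≤⟨ *-monoʳ-≤ (2 * k) (*-monoʳ-≤ t (m≤m*n t n² {{>-nonZero 1≤n²}})) ⟩
    overhead         ≤⟨ overhead≤2^c ⟩
    2 ^ c            ≤⟨ ^-monoʳ-≤ 2 (≤-trans (m≤m+n c (c + 0)) 2c≤n²) ⟩
    2 ^ n²           ∎

  t+tn²≤n⁶ : t + t * n² ≤ n ^ 6
  t+tn²≤n⁶ = begin
    t + t * n²     ≡⟨ *-suc t n² ⟨
    t * suc n²     ≤⟨ *-mono-≤ t≤n³ 1+n²≤n³ ⟩
    n ^ 3 * n ^ 3  ≡⟨ ^-distribˡ-+-* n 3 3 ⟨
    n ^ 6          ∎
    where
    1+n²≤n³ : suc n² ≤ n ^ 3
    1+n²≤n³ = begin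
      suc n²    ≤⟨ +-monoˡ-≤ n² 1≤n² ⟩
      n² + n²   ≡⟨ cong (n² +_) (+-identityʳ n²) ⟨
      2 * n²    ≤⟨ *-monoˡ-≤ n² 2≤n ⟩
      n * n²    ≡⟨ cong (λ x → n * (n * x)) (*-identityʳ n) ⟨
      n ^ 3     ∎

  choices≤2^[36sL] : ∀ s → (n ^ 6) ^ (2 * s) * suc t ^ s ≤ 2 ^ (s * L * 36)
  choices≤2^[36sL] s = begin
    (n ^ 6) ^ (2 * s) * suc t ^ s    ≤⟨ *-monoʳ-≤ ((n ^ 6) ^ (2 * s)) (^-monoˡ-≤ s 1+t≤n⁶) ⟩
    (n ^ 6) ^ (2 * s) * (n ^ 6) ^ s  ≡⟨ ^-distribˡ-+-* (n ^ 6) (2 * s) s ⟨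
    (n ^ 6) ^ (2 * s + s)            ≤⟨ ^-monoˡ-≤ (2 * s + s) (^-monoˡ-≤ 6 (<⇒≤ (n<2^[1+⌊log₂n⌋] n))) ⟩
    ((2 ^ suc L) ^ 6) ^ (2 * s + s)  ≡⟨ cong (_^ (2 * s + s)) (^-*-assoc 2 (suc L) 6) ⟩
    (2 ^ (suc L * 6)) ^ (2 * s + s)  ≡⟨ ^-*-assoc 2 (suc L * 6) (2 * s + s) ⟩
    2 ^ (suc L * 6 * (2 * s + s))    ≤⟨ ^-monoʳ-≤ 2 exponent ⟩
    2 ^ (s * L * 36)                 ∎
    where
    1+t≤n⁶ : suc t ≤ n ^ 6
    1+t≤n⁶ = ≤-trans (≤-reflexive (+-comm 1 t))
                     (≤-trans (+-monoʳ-≤ t (*-mono-≤ 1≤t 1≤n²)) t+tn²≤n⁶)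
    regroup : ∀ L s → suc L * 6 * (2 * s + s) ≡ s * L * 18 + s * 18
    regroup = solve-∀
    exponent : suc L * 6 * (2 * s + s) ≤ s * L * 36
    exponent = begin
      suc L * 6 * (2 * s + s)  ≡⟨ regroup L s ⟩
      s * L * 18 + s * 18      ≤⟨ +-monoʳ-≤ (s * L * 18) (*-monoˡ-≤ 18 (m≤m*n s L {{>-nonZero 1≤L}})) ⟩
      s * L * 18 + s * L * 18  ≡⟨ *-distribˡ-+ (s * L) 18 18 ⟨
      s * L * 36               ∎

  -- 72 s L and 2c are both below (t − r) n², hence so is 36 s L + c.
  cheap-exponent : ∀ {r s} → r < t → Cheap n t r s → s * L * 36 + c + n² * r ≤ t * n²
  cheap-exponent {r} {s} r<t cheap = begin
    s * L * 36 + c + n² * r  ≤⟨ +-monoˡ-≤ (n² * r) (<⇒≤ below-D) ⟩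
    D + n² * r               ≡⟨ cong (D +_) (*-comm n² r) ⟩
    (t ∸ r) * n² + r * n²    ≡⟨ *-distribʳ-+ n² (t ∸ r) r ⟨
    (t ∸ r + r) * n²         ≡⟨ cong (_* n²) (m∸n+n≡m (<⇒≤ r<t)) ⟩
    t * n²                   ∎
    where
    D = (t ∸ r) * n²
    n²≤D : n² ≤ D
    n²≤D = m≤n*m n² (t ∸ r) {{>-nonZero (m<n⇒0<n∸m r<t)}}
    double : ∀ e c → 2 * (e * 36 + c) ≡ e * 72 + 2 * c
    double = solve-∀
    below-D : s * L * 36 + c < D
    below-D = *-cancelˡ-< 2 _ _ (begin-strict
      2 * (s * L * 36 + c)  ≡⟨ double (s * L) c ⟩
      s * L * 72 + 2 * c    <⟨ +-mono-<-≤ (subst (s * L * 72 <_) (cong (_* n²) (*-identityˡ (t ∸ r))) cheap)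
                                          (≤-trans 2c≤n² n²≤D) ⟩
      D + D                 ≡⟨ cong (D +_) (+-identityʳ D) ⟨
      2 * D                 ∎)

  shape-bound : ∀ {r s} → r < t → Cheap n t r s →
                (n ^ 6) ^ (2 * s) * (suc t ^ s * (2 ^ n²) ^ r) * overhead ≤ 2 ^ (t * n²)
  shape-bound {r} {s} r<t cheap = begin
    G * (O * (2 ^ n²) ^ r) * overhead          ≡⟨ regroup G O ((2 ^ n²) ^ r) overhead ⟩
    G * O * overhead * (2 ^ n²) ^ r            ≤⟨ *-mono-≤ (*-mono-≤ (choices≤2^[36sL] s) overhead≤2^c)
                                                           (≤-reflexive (^-*-assoc 2 n² r)) ⟩
    2 ^ (s * L * 36) * 2 ^ c * 2 ^ (n² * r)    ≡⟨ cong (_* 2 ^ (n² * r)) (^-distribˡ-+-* 2 (s * L * 36) c) ⟨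
    2 ^ (s * L * 36 + c) * 2 ^ (n² * r)        ≡⟨ ^-distribˡ-+-* 2 (s * L * 36 + c) (n² * r) ⟨
    2 ^ (s * L * 36 + c + n² * r)              ≤⟨ ^-monoʳ-≤ 2 (cheap-exponent {s = s} r<t cheap) ⟩
    2 ^ (t * n²)                               ∎
    where
    G = (n ^ 6) ^ (2 * s)
    O = suc t ^ s
    regroup : ∀ g o p c → g * (o * p) * c ≡ g * o * c * p
    regroup = solve-∀

  length-cheapDecodings : length (cheapDecodings n t) * (2 * k) ≤ 2 ^ (t * n²)
  length-cheapDecodings = *-cancelʳ-≤ _ _ (t * (t * n²)) {{>-nonZero (*-mono-≤ 1≤t (*-mono-≤ 1≤t 1≤n²))}} (begin
    length (cheapDecodings n t) * (2 * k) * (t * (t * n²))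
      ≡⟨ *-assoc (length (cheapDecodings n t)) (2 * k) _ ⟩
    length (cheapDecodings n t) * overhead
      ≤⟨ length-concatMap-*-≤ (cheapDecodingsAt n t) (upTo t) (length-cheapDecodingsAt ∘ ∈-upTo⁻) ⟩
    length (upTo t) * (t * n² * 2 ^ (t * n²))
      ≡⟨ cong (_* (t * n² * 2 ^ (t * n²))) (length-upTo t) ⟩
    t * (t * n² * 2 ^ (t * n²))
      ≡⟨ regroup t (t * n²) (2 ^ (t * n²)) ⟩
    2 ^ (t * n²) * (t * (t * n²))
      ∎)
    where
    regroup : ∀ a b c → a * (b * c) ≡ c * (a * b)
    regroup = solve-∀
    length-cheapDecodingsAt : ∀ {r} → r < t → length (cheapDecodingsAt n t r) * overhead ≤ t * n² * 2 ^ (t * n²)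
    length-cheapDecodingsAt {r} r<t =
      ≤-trans (length-concatMap-*-≤ _ shapes λ {s} s∈ → shape {s} (proj₂ (∈-filter⁻ (cheap? n t r) {s} {upTo (t * n²)} s∈)))
              (*-monoˡ-≤ _ (≤-trans (length-filter (cheap? n t r) (upTo (t * n²))) (≤-reflexive (length-upTo (t * n²)))))
      where
      shapes = filter (cheap? n t r) (upTo (t * n²))
      shape : ∀ {s} → Cheap n t r s → length (decodings t r s n²) * overhead ≤ 2 ^ (t * n²)
      shape {s} cheap =
        ≤-trans (*-monoˡ-≤ overhead (length-decodings t r s n² r+s≤n⁶)) (shape-bound {s = s} r<t cheap)
        where
        r+s≤n⁶ : r + s ≤ n ^ 6
        r+s≤n⁶ = ≤-trans (+-mono-≤ (<⇒≤ r<t) (<⇒≤ (cheap⇒s<tn² {n} {t} {r} {s} 2≤n cheap))) t+tn²≤n⁶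

  length-badCover : length (badCover n t) * k ≤ 2 ^ (t * n²)
  length-badCover = *-cancelʳ-≤ _ _ 2 (begin
    length (R ++ C) * k * 2                  ≡⟨ cong (λ l → l * k * 2) (length-++ R) ⟩
    (length R + length C) * k * 2            ≡⟨ regroup (length R) (length C) k ⟩
    length R * (2 * k) + length C * (2 * k)  ≤⟨ +-mono-≤ (length-redundantRowMatrices-* t n² 2kt²≤2^n²)
                                                          length-cheapDecodings ⟩
    2 ^ (t * n²) + 2 ^ (t * n²)              ≡⟨ double (2 ^ (t * n²)) ⟩
    2 ^ (t * n²) * 2                         ∎)
    where
    R = redundantRowMatrices t n²
    C = cheapDecodings n t
    regroup : ∀ a b k → (a + b) * k * 2 ≡ a * (2 * k) + b * (2 * k)
    regroup = solve-∀
    double : ∀ a → a + a ≡ a * 2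
    double = solve-∀

theoremB2 : Σ ℕ λ p → Σ ℕ λ q → (0 < p) × (0 < q) ×
    ((k : ℕ) → 0 < k → Σ ℕ λ N → (n t : ℕ) → N ≤ n → n * n ≤ t → t ^ 100 < n ^ 281 →
      Σ (List (Mat t (n * n))) λ L → (length L * k ≤ 2 ^ (t * (n * n))) ×
        ((X : Mat t (n * n)) → Bad p q n t X → Any (λ Y → ∀ i j → Y i j ≡ X i j) L))
theoremB2 = 1 , 72 , z<s , z<s , λ k _ → 2 * k + 18 , λ n t n-large n²≤t t¹⁰⁰<n²⁸¹ →
  let 2≤n = large⇒2≤n {k = k} n-large in
  badCover n t ,
  Counting.length-badCover n-large n²≤t (t≤n³ (≤-trans (s≤s z≤n) 2≤n) t¹⁰⁰<n²⁸¹) ,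
  badCover-complete 2≤n
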